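{- Let $(G,w)$ be a \textsc{MinPSC} instance, $\ell\colon V\to\mathbb{N}$ be vertex lower bounds for $G=(V,E)$, and $\mathrm{col}\colon V\to C$ be a coloring such that, for $i\ne j$, the sets of colors of vertices in the connected components $G_\ell^i$ and $G_\ell^j$ of $G_\ell=(V,E_\ell)$ are disjoint. If $T=(W,F)$ is an optimal solution to the \textsc{MinPCCS} instance $I=(G_\ell^\bullet,w_\ell^\bullet,\mathrm{col},\ell,C)$, then $T'=(V,(F\cap E)\cup E_\ell)$ is a solution for $(G,w)$ of cost at most $\mathrm{opt}(I)+\sum_{v\in V\setminus W}\ell(v)$.
   Context: \textsc{MinPSC}: given a connected undirected graph $G=(V,E)$ with edge weights $w\colon E\to\mathbb{N}$, find a connected spanning subgraph $T=(V,F)$ minimizing $\sum_{v\in V}\max_{\{u,v\}\in F}w(\{u,v\})$. Vertex lower bounds: a function $\ell\colon V\to\mathbb{N}$ such that in every solution $T=(V,F)$ and every $v$, $\max_{\{u,v\}\in F}w(\{u,v\})\ge\ell(v)$. The obligatory subgraph $G_\ell$ has vertex set $V$ and edge set $E_\ell$ of all edges $\{u,v\}$ with $\min\{\ell(u),\ell(v)\}\ge w(\{u,v\})$; its connected components are $G_\ell^1,\dots,G_\ell^c$. The padded graph $G_\ell^\bullet=(V,E_\ell^\bullet)$ with weights $w_\ell^\bullet$ is obtained from $G$ by adding zero-weight edges between each pair of non-adjacent vertices within each $G_\ell^i$. \textsc{MinPCCS}: given a connected graph, edge weights $w$, vertex colors $\mathrm{col}$, $\ell\colon V\to\mathbb{N}$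 and a color set $C$, compute a connected subgraph $T=(W,F)$ such that $\mathrm{col}$ is a bijection between $W$ and $C$, minimizing $\sum_{v\in W}\max\{\ell(v),\max_{\{u,v\}\in F}w(\{u,v\})\}$. Here $\mathrm{opt}(I)$ denotes the optimal \textsc{MinPCCS} cost of $I$. -}

module Defs where

open import Data.Nat using (ℕ; zero; suc; _+_; _≤_; _⊔_; _⊓_)
open import Data.Nat.Properties using (_≤?_)
open import Data.Fin using (Fin; zero; suc)
open import Data.Bool using (Bool; true; false; if_then_else_; _∧_; _∨_; not)
open import Data.Product using (_×_; Σ; ∃; _,_)
open import Data.Sum using (_⊎_)
open import Relation.Binary.PropositionalEquality using (_≡_; _≢_)
open import Relation.Nullary.Decidable using (⌊_⌋)
open import Relation.Nullary using (¬_)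

-- Vertices are Fin n.  Edge sets / adjacency relations are Bool-valued
-- relations on vertices (an edge {u,v} is present iff R u v ≡ true).
Rel₂ : ℕ → Set
Rel₂ n = Fin n → Fin n → Bool

sumF : ∀ {n} → (Fin n → ℕ) → ℕ
sumF {zero}  f = 0
sumF {suc n} f = f zero + sumF (λ i → f (suc i))

maxF : ∀ {n} → (Fin n → ℕ) → ℕ
maxF {zero}  f = 0
maxF {suc n} f = f zero ⊔ maxF (λ i → f (suc i))

data Reach {n : ℕ} (R : Rel₂ n) : Fin n → Fin n → Set where
  here : ∀ {u} → Reach R u u
  step : ∀ {u v x} → R u v ≡ true → Reach R v x → Reach R u x

Symmetric : ∀ {n} → Rel₂ n → Set
Symmetric R = ∀ u v → R u v ≡ R v u

Irreflexive : ∀ {n} → Rel₂ n → Set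
Irreflexive R = ∀ u → R u u ≡ false

SymW : ∀ {n} → (Fin n → Fin n → ℕ) → Set
SymW w = ∀ u v → w u v ≡ w v u

IsGraph : ∀ {n} → Rel₂ n → Set
IsGraph adj = Symmetric adj × Irreflexive adj

_⊆ᴱ_ : ∀ {n} → Rel₂ n → Rel₂ n → Set
F ⊆ᴱ E = ∀ u v → F u v ≡ true → E u v ≡ true

Connected : ∀ {n} → Rel₂ n → Set
Connected {n} adj = ∀ (u v : Fin n) → Reach adj u v

maxInc : ∀ {n} → Rel₂ n → (Fin n → Fin n → ℕ) → Fin n → ℕ
maxInc F w v = maxF (λ u → if F u v then w u v else 0)

IsPSCSolution : ∀ {n} → Rel₂ n → Rel₂ n → Set
IsPSCSolution adj F = Symmetric F × F ⊆ᴱ adj × Connected F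

pscCost : ∀ {n} → Rel₂ n → (Fin n → Fin n → ℕ) → ℕ
pscCost F w = sumF (λ v → maxInc F w v)

IsLowerBound : ∀ {n} → Rel₂ n → (Fin n → Fin n → ℕ) → (Fin n → ℕ) → Set
IsLowerBound {n} adj w ℓ =
  ∀ (F : Rel₂ n) → IsPSCSolution adj F → ∀ v → ℓ v ≤ maxInc F w v

Eℓ : ∀ {n} → Rel₂ n → (Fin n → Fin n → ℕ) → (Fin n → ℕ) → Rel₂ n
Eℓ adj w ℓ u v = adj u v ∧ ⌊ w u v ≤? (ℓ u ⊓ ℓ v) ⌋

SameComp : ∀ {n} → Rel₂ n → (Fin n → Fin n → ℕ) → (Fin n → ℕ) → Fin n → Fin n → Set
SameComp adj w ℓ u v = Reach (Eℓ adj w ℓ) u v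

PadEdge : ∀ {n} → Rel₂ n → (Fin n → Fin n → ℕ) → (Fin n → ℕ) → Fin n → Fin n → Set
PadEdge adj w ℓ u v = adj u v ≡ true ⊎ (u ≢ v × SameComp adj w ℓ u v)

wPad : ∀ {n} → Rel₂ n → (Fin n → Fin n → ℕ) → Fin n → Fin n → ℕ
wPad adj w u v = if adj u v then w u v else 0

-- MinPCCS feasible solutions T = (W,F) in a graph whose edge set is the
-- predicate Edge, with colour map col : V → Fin k (colour set C = Fin k):
-- F is a symmetric edge set of the host graph with both endpoints in W,
-- T is connected, and col restricted to W is a bijection W → C.
IsPCCSSolution : ∀ {n k} → (Fin n → Fin n → Set) → (Fin n → Fin k) →
                 (Fin n → Bool) → Rel₂ n → Set
IsPCCSSolution {n} {k} Edge col W F =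
  Symmetric F ×
  (∀ u v → F u v ≡ true → Edge u v) ×
  (∀ u v → F u v ≡ true → W u ≡ true × W v ≡ true) ×
  (∀ u v → W u ≡ true → W v ≡ true → Reach F u v) ×
  (∀ u v → W u ≡ true → W v ≡ true → col u ≡ col v → u ≡ v) ×
  (∀ (c : Fin k) → Σ (Fin n) (λ v → W v ≡ true × col v ≡ c))

pccsCost : ∀ {n} → (Fin n → Fin n → ℕ) → (Fin n → ℕ) → (Fin n → Bool) → Rel₂ n → ℕ
pccsCost w ℓ W F = sumF (λ v → if W v then ℓ v ⊔ maxInc F w v else 0)

IsPCCSOptimal : ∀ {n k} → (Fin n → Fin n → Set) → (Fin n → Fin n → ℕ) →
                (Fin n → Fin k) → (Fin n → ℕ) → (Fin n → Bool) → Rel₂ n → Set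
IsPCCSOptimal {n} Edge w col ℓ W F =
  IsPCCSSolution Edge col W F ×
  (∀ (W' : Fin n → Bool) (F' : Rel₂ n) → IsPCCSSolution Edge col W' F' →
     pccsCost w ℓ W F ≤ pccsCost w ℓ W' F')

module Submission where

-- Every MinPCCS edge of the padded graph is either an edge of G, which T' keeps,
-- or a padding edge inside a component of G_ℓ, which T' spans by obligatory edges;
-- and every vertex x lies in the G_ℓ-component of the vertex of W with colour
-- col x, because colours of distinct components are disjoint.  Hence T' is
-- connected.  At a vertex v, a kept edge weighs at most the MinPCCS cost of v
-- (its endpoint v lies in W), and an obligatory edge weighs at most ℓ v, which is
-- paid by the MinPCCS cost if v ∈ W and by the extra term otherwise.

open import Defs
open import Data.Nat using (ℕ; _+_; _≤_)
open import Data.Fin using (Fin)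
open import Data.Bool using (Bool; if_then_else_; _∧_; _∨_)
open import Relation.Binary.PropositionalEquality using (_≡_; _≢_)
open import Relation.Nullary using (¬_)
open import Data.Product using (_×_)

open import Data.Nat using (zero; suc; _<_; _⊔_; _⊓_; z≤n; s≤s)
open import Data.Nat.Properties
  using (≤-refl; ≤-trans; ≤-reflexive; +-mono-≤; +-mono-<-≤; +-mono-≤-<; ⊔-lub; m≤m⊔n; m≤n⊔m;
         m⊓n≤n; ⊓-comm; m≤m+n; m≤n+m; m≤n⇒m≤1+n; <⇒≱; _≤?_; +-commutativeSemigroup)
open import Algebra.Properties.CommutativeSemigroup +-commutativeSemigroup using (interchange)
open import Data.Fin using (zero; suc) renaming (_≟_ to _≟ᶠ_)
open import Data.Fin.Properties using (all?; any?; ¬∀⟶∃¬)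
open import Data.Bool using (true; false)
open import Data.Bool.Properties using () renaming (_≟_ to _≟ᵇ_)
open import Data.Product using (Σ; _,_; proj₁; proj₂)
open import Data.Sum using (_⊎_; inj₁; inj₂)
open import Data.Empty using (⊥-elim)
open import Function using (case_of_)
open import Relation.Nullary using (Dec; yes; no)
open import Relation.Nullary.Decidable using (⌊_⌋)
open import Relation.Binary.PropositionalEquality using (refl; sym; trans; cong; cong₂)

∧-true⁻ : ∀ a b → a ∧ b ≡ true → a ≡ true × b ≡ true
∧-true⁻ true true _ = refl , refl

∧-true : ∀ {a b} → a ≡ true → b ≡ true → a ∧ b ≡ true
∧-true refl refl = refl

∨-true⁻ : ∀ a b → a ∨ b ≡ true → a ≡ true ⊎ b ≡ true
∨-true⁻ true  _ _ = inj₁ refl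
∨-true⁻ false _ p = inj₂ p

∨-trueˡ : ∀ {a} b → a ≡ true → a ∨ b ≡ true
∨-trueˡ _ refl = refl

∨-trueʳ : ∀ a {b} → b ≡ true → a ∨ b ≡ true
∨-trueʳ true  _ = refl
∨-trueʳ false p = p

⌊⌋-true⁻ : ∀ {p} {P : Set p} (d : Dec P) → ⌊ d ⌋ ≡ true → P
⌊⌋-true⁻ (yes p) _ = p

⌊⌋-true : ∀ {p} {P : Set p} (d : Dec P) → P → ⌊ d ⌋ ≡ true
⌊⌋-true (yes _) _  = refl
⌊⌋-true (no ¬p) p = ⊥-elim (¬p p)

if-≤ : ∀ (b : Bool) {m o} → (b ≡ true → m ≤ o) → (if b then m else 0) ≤ o
if-≤ true  h = h refl
if-≤ false h = z≤n

maxF-≥ : ∀ {n} (f : Fin n → ℕ) i → f i ≤ maxF f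
maxF-≥ f zero    = m≤m⊔n _ _
maxF-≥ f (suc i) = ≤-trans (maxF-≥ (λ j → f (suc j)) i) (m≤n⊔m (f zero) _)

maxF-lub : ∀ {n} (f : Fin n → ℕ) {m} → (∀ i → f i ≤ m) → maxF f ≤ m
maxF-lub {zero}  f h = z≤n
maxF-lub {suc n} f h = ⊔-lub (h zero) (maxF-lub (λ j → f (suc j)) (λ j → h (suc j)))

sumF-≥ : ∀ {n} (f : Fin n → ℕ) i → f i ≤ sumF f
sumF-≥ f zero    = m≤m+n _ _
sumF-≥ f (suc i) = ≤-trans (sumF-≥ (λ j → f (suc j)) i) (m≤n+m _ (f zero))

sumF-mono-≤ : ∀ {n} {f g : Fin n → ℕ} → (∀ i → f i ≤ g i) → sumF f ≤ sumF g
sumF-mono-≤ {zero}  h = z≤n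
sumF-mono-≤ {suc n} h = +-mono-≤ (h zero) (sumF-mono-≤ (λ j → h (suc j)))

sumF-mono-< : ∀ {n} {f g : Fin n → ℕ} → (∀ i → f i ≤ g i) → ∀ v → f v < g v → sumF f < sumF g
sumF-mono-< h zero    lt = +-mono-<-≤ lt (sumF-mono-≤ (λ j → h (suc j)))
sumF-mono-< h (suc v) lt = +-mono-≤-< (h zero) (sumF-mono-< (λ j → h (suc j)) v lt)

sumF-+ : ∀ {n} (f g : Fin n → ℕ) → sumF (λ i → f i + g i) ≡ sumF f + sumF g
sumF-+ {zero}  f g = refl
sumF-+ {suc n} f g = trans (cong (f zero + g zero +_) (sumF-+ (λ j → f (suc j)) (λ j → g (suc j))))
                           (interchange (f zero) (g zero) _ _)

maxInc-≥ : ∀ {n} (F : Rel₂ n) (w : Fin n → Fin n → ℕ) {u v} → F u v ≡ true → w u v ≤ maxInc F w v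
maxInc-≥ F w {u} {v} e = ≤-trans (≤-reflexive (cong (λ b → if b then w u v else 0) (sym e)))
                                 (maxF-≥ (λ u' → if F u' v then w u' v else 0) u)

maxInc-lub : ∀ {n} (F : Rel₂ n) (w : Fin n → Fin n → ℕ) {v m} →
             (∀ u → F u v ≡ true → w u v ≤ m) → maxInc F w v ≤ m
maxInc-lub F w {v} h = maxF-lub _ (λ u → if-≤ (F u v) (h u))

size : ∀ {n} → (Fin n → Bool) → ℕ
size S = sumF (λ i → if S i then 1 else 0)

size-≤ : ∀ {n} (S : Fin n → Bool) → size S ≤ n
size-≤ {zero}  S = z≤n
size-≤ {suc n} S with S zero
... | true  = s≤s (size-≤ (λ j → S (suc j)))
... | false = m≤n⇒m≤1+n (size-≤ (λ j → S (suc j)))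

size-> : ∀ {n} (S : Fin n → Bool) v → S v ≡ true → 0 < size S
size-> S v e = ≤-trans (≤-reflexive (cong (λ b → if b then 1 else 0) (sym e)))
                       (sumF-≥ (λ i → if S i then 1 else 0) v)

_⊆ᵇ_ : ∀ {n} → (Fin n → Bool) → (Fin n → Bool) → Set
S ⊆ᵇ S' = ∀ v → S v ≡ true → S' v ≡ true

size-grows : ∀ {n} (S S' : Fin n → Bool) → S ⊆ᵇ S' → (∀ v → S' v ≡ S v) ⊎ size S < size S'
size-grows {n} S S' S⊆S' with all? (λ v → S' v ≟ᵇ S v)
... | yes same = inj₁ same
... | no ¬same with ¬∀⟶∃¬ n _ (λ v → S' v ≟ᵇ S v) ¬same
...   | v , S'v≢Sv = inj₂ (sumF-mono-< (λ i → indicator-mono (S i) (S' i) (S⊆S' i))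
                                    v (indicator-< (S v) (S' v) (S⊆S' v) S'v≢Sv))
  where
    indicator-mono : ∀ a b → (a ≡ true → b ≡ true) → (if a then 1 else 0) ≤ (if b then 1 else 0)
    indicator-mono true  true  _ = ≤-refl
    indicator-mono true  false h with () ← h refl
    indicator-mono false _     _ = z≤n

    indicator-< : ∀ a b → (a ≡ true → b ≡ true) → b ≢ a → (if a then 1 else 0) < (if b then 1 else 0)
    indicator-< false true  _ _  = s≤s z≤n
    indicator-< false false _ ne = ⊥-elim (ne refl)
    indicator-< true  _     h ne = ⊥-elim (ne (h refl))

Reach-edge : ∀ {n} {R : Rel₂ n} {u v} → R u v ≡ true → Reach R u v
Reach-edge e = step e here

Reach-trans : ∀ {n} {R : Rel₂ n} {x u v} → Reach R x u → Reach R u v → Reach R x v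
Reach-trans here       r' = r'
Reach-trans (step e r) r' = step e (Reach-trans r r')

Reach-bind : ∀ {n} {R R' : Rel₂ n} → (∀ u v → R u v ≡ true → Reach R' u v) →
             ∀ {x y} → Reach R x y → Reach R' x y
Reach-bind h here                 = here
Reach-bind h (step {u} {v} e r) = Reach-trans (h u v e) (Reach-bind h r)

Reach-sym : ∀ {n} {R : Rel₂ n} → Symmetric R → ∀ {x y} → Reach R x y → Reach R y x
Reach-sym s here                 = here
Reach-sym s (step {u} {v} e r) = Reach-trans (Reach-sym s r) (Reach-edge (trans (s v u) e))

-- The sets of vertices reachable from x in at most k steps grow strictly until
-- they are closed under R, so they are closed after n steps.
module Reachability {n} (R : Rel₂ n) (x : Fin n) where

  within : ℕ → Fin n → Bool
  within zero    v = ⌊ x ≟ᶠ v ⌋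
  within (suc k) v = within k v ∨ ⌊ any? (λ u → within k u ∧ R u v ≟ᵇ true) ⌋

  within-sound : ∀ k v → within k v ≡ true → Reach R x v
  within-sound zero v e with refl ← ⌊⌋-true⁻ (x ≟ᶠ v) e = here
  within-sound (suc k) v e with ∨-true⁻ (within k v) _ e
  ... | inj₁ p = within-sound k v p
  ... | inj₂ p with u , q ← ⌊⌋-true⁻ (any? (λ u → within k u ∧ R u v ≟ᵇ true)) p
                  with ku , uv ← ∧-true⁻ (within k u) (R u v) q
                  = Reach-trans (within-sound k u ku) (Reach-edge uv)

  within-start : within zero x ≡ true
  within-start = ⌊⌋-true (x ≟ᶠ x) refl

  within-suc : ∀ k → within k ⊆ᵇ within (suc k)
  within-suc k v = ∨-trueˡ _

  within-⊆ : ∀ k → within zero ⊆ᵇ within k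
  within-⊆ zero    v e = e
  within-⊆ (suc k) v e = within-suc k v (within-⊆ k v e)

  within-step : ∀ k {u v} → within k u ≡ true → R u v ≡ true → within (suc k) v ≡ true
  within-step k {u} {v} ku uv =
    ∨-trueʳ (within k v) (⌊⌋-true (any? (λ u → within k u ∧ R u v ≟ᵇ true)) (u , ∧-true ku uv))

  Closed : (Fin n → Bool) → Set
  Closed S = ∀ u v → S u ≡ true → R u v ≡ true → S v ≡ true

  closed-suc : ∀ k → Closed (within k) → Closed (within (suc k))
  closed-suc k closed u v ku uv = within-suc k v (closed u v (shrink u ku) uv)
    where
      shrink : within (suc k) ⊆ᵇ within k
      shrink v e with ∨-true⁻ (within k v) _ e
      ... | inj₁ p = p
      ... | inj₂ p with u , q ← ⌊⌋-true⁻ (any? (λ u → within k u ∧ R u v ≟ᵇ true)) p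
                      with ku , uv ← ∧-true⁻ (within k u) (R u v) q
                      = closed u v ku uv

  closed-or-large : ∀ k → Closed (within k) ⊎ k < size (within k)
  closed-or-large zero = inj₂ (size-> (within zero) x within-start)
  closed-or-large (suc k) with closed-or-large k
  ... | inj₁ closed = inj₁ (closed-suc k closed)
  ... | inj₂ large with size-grows (within k) (within (suc k)) (within-suc k)
  ...   | inj₁ same = inj₁ (closed-suc k (λ u v ku uv → trans (sym (same v)) (within-step k ku uv)))
  ...   | inj₂ grows = inj₂ (≤-trans (s≤s large) grows)

  within-closed : Closed (within n)
  within-closed with closed-or-large n
  ... | inj₁ closed = closed
  ... | inj₂ large  = ⊥-elim (<⇒≱ large (size-≤ (within n)))

  within-complete : ∀ {v} → Reach R x v → within n v ≡ true
  within-complete = go (within-⊆ n x within-start)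
    where
      go : ∀ {u v} → within n u ≡ true → Reach R u v → within n v ≡ true
      go e here               = e
      go e (step {u} {v} uv r) = go (within-closed u v e uv) r

  Reach? : ∀ y → Dec (Reach R x y)
  Reach? y with within n y in e
  ... | true  = yes (within-sound n y e)
  ... | false = no λ r → case trans (sym e) (within-complete r) of λ ()

_∩ᴱ_ : ∀ {n} → Rel₂ n → Rel₂ n → Rel₂ n
(F ∩ᴱ E) u v = F u v ∧ E u v

_∪ᴱ_ : ∀ {n} → Rel₂ n → Rel₂ n → Rel₂ n
(F ∪ᴱ E) u v = F u v ∨ E u v

∩ᴱ-sym : ∀ {n} {F E : Rel₂ n} → Symmetric F → Symmetric E → Symmetric (F ∩ᴱ E)
∩ᴱ-sym sF sE u v = cong₂ _∧_ (sF u v) (sE u v)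

∪ᴱ-sym : ∀ {n} {F E : Rel₂ n} → Symmetric F → Symmetric E → Symmetric (F ∪ᴱ E)
∪ᴱ-sym sF sE u v = cong₂ _∨_ (sF u v) (sE u v)

-- The cost of a vertex v in the bound: its MinPCCS cost ℓ v ⊔ m if v ∈ W, else ℓ v.
charge : Bool → ℕ → ℕ → ℕ
charge b x m = (if b then x ⊔ m else 0) + (if b then 0 else x)

≤-chargeˡ : ∀ b {x m} → x ≤ charge b x m
≤-chargeˡ true  = ≤-trans (m≤m⊔n _ _) (m≤m+n _ 0)
≤-chargeˡ false = ≤-refl

≤-chargeʳ : ∀ {b x m} → b ≡ true → m ≤ charge b x m
≤-chargeʳ {x = x} refl = ≤-trans (m≤n⊔m x _) (m≤m+n _ 0)

module Obligatory {n} (adj : Rel₂ n) (w : Fin n → Fin n → ℕ) (ℓ : Fin n → ℕ) where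

  E : Rel₂ n
  E = Eℓ adj w ℓ

  Eℓ-sym : Symmetric adj → SymW w → Symmetric E
  Eℓ-sym sa sw u v = cong₂ _∧_ (sa u v) (cong₂ (λ a b → ⌊ a ≤? b ⌋) (sw u v) (⊓-comm (ℓ u) (ℓ v)))

  Eℓ⊆adj : E ⊆ᴱ adj
  Eℓ⊆adj u v e = proj₁ (∧-true⁻ (adj u v) _ e)

  Eℓ-≤ : ∀ {u v} → E u v ≡ true → w u v ≤ ℓ v
  Eℓ-≤ {u} {v} e = ≤-trans (⌊⌋-true⁻ (w u v ≤? ℓ u ⊓ ℓ v) (proj₂ (∧-true⁻ (adj u v) _ e)))
                           (m⊓n≤n (ℓ u) (ℓ v))

  -- The disjointness hypothesis only refutes ¬ SameComp; deciding reachability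
  -- turns that into an actual path.
  sameColour⇒SameComp : ∀ {k} (col : Fin n → Fin k) →
                        (∀ u v → ¬ SameComp adj w ℓ u v → col u ≢ col v) →
                        ∀ {u v} → col u ≡ col v → SameComp adj w ℓ u v
  sameColour⇒SameComp col disjoint {u} {v} same with Reachability.Reach? E u v
  ... | yes r = r
  ... | no ¬r = ⊥-elim (disjoint u v ¬r same)

  lifted : Rel₂ n → Rel₂ n
  lifted F = (F ∩ᴱ adj) ∪ᴱ E

  module Lift {k} (col : Fin n → Fin k) (W : Fin n → Bool) (F : Rel₂ n) where

    lifted-isPSCSolution : Symmetric adj → SymW w →
                           (∀ u v → ¬ SameComp adj w ℓ u v → col u ≢ col v) →
                           IsPCCSSolution (PadEdge adj w ℓ) col W F → IsPSCSolution adj (lifted F)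
    lifted-isPSCSolution sa sw disjoint (sF , F⊆pad , _ , connW , _ , onto) =
      ∪ᴱ-sym (∩ᴱ-sym sF sa) symE , lifted⊆adj , connected
      where
        symE : Symmetric E
        symE = Eℓ-sym sa sw

        lifted⊆adj : lifted F ⊆ᴱ adj
        lifted⊆adj u v e with ∨-true⁻ ((F ∩ᴱ adj) u v) _ e
        ... | inj₁ p = proj₂ (∧-true⁻ (F u v) _ p)
        ... | inj₂ p = Eℓ⊆adj u v p

        E⇒lifted : ∀ u v → E u v ≡ true → Reach (lifted F) u v
        E⇒lifted u v e = Reach-edge (∨-trueʳ ((F ∩ᴱ adj) u v) e)

        F⇒lifted : ∀ u v → F u v ≡ true → Reach (lifted F) u v
        F⇒lifted u v e with F⊆pad u v e
        ... | inj₁ a       = Reach-edge (cong (_∨ E u v) (∧-true e a))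
        ... | inj₂ (_ , c) = Reach-bind E⇒lifted c

        representative : ∀ x → Σ (Fin n) λ a → W a ≡ true × SameComp adj w ℓ x a
        representative x with a , a∈W , col-a ← onto (col x) =
          a , a∈W , sameColour⇒SameComp col disjoint (sym col-a)

        connected : Connected (lifted F)
        connected x y with a , a∈W , xa ← representative x | b , b∈W , yb ← representative y =
          Reach-trans (Reach-bind E⇒lifted xa)
            (Reach-trans (Reach-bind F⇒lifted (connW a b a∈W b∈W))
                         (Reach-bind E⇒lifted (Reach-sym symE yb)))

    lifted-cost : (∀ u v → F u v ≡ true → W u ≡ true × W v ≡ true) →
                  pscCost (lifted F) w ≤ pccsCost (wPad adj w) ℓ W F + sumF (λ v → if W v then 0 else ℓ v)
    lifted-cost F⊆W = ≤-trans (sumF-mono-≤ vertex-cost)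
                              (≤-reflexive (sumF-+ (λ v → if W v then ℓ v ⊔ maxInc F (wPad adj w) v else 0)
                                                   (λ v → if W v then 0 else ℓ v)))
      where
        vertex-cost : ∀ v → maxInc (lifted F) w v ≤ charge (W v) (ℓ v) (maxInc F (wPad adj w) v)
        vertex-cost v = maxInc-lub (lifted F) w edge-cost
          where
            edge-cost : ∀ u → lifted F u v ≡ true → w u v ≤ charge (W v) (ℓ v) (maxInc F (wPad adj w) v)
            edge-cost u e with ∨-true⁻ ((F ∩ᴱ adj) u v) _ e
            ... | inj₂ p = ≤-trans (Eℓ-≤ p) (≤-chargeˡ (W v))
            ... | inj₁ p with uv∈F , uv∈adj ← ∧-true⁻ (F u v) _ p =
              ≤-trans (≤-trans (≤-reflexive (cong (λ b → if b then w u v else 0) (sym uv∈adj)))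
                               (maxInc-≥ F (wPad adj w) uv∈F))
                      (≤-chargeʳ (proj₂ (F⊆W u v uv∈F)))

lemma2 : ∀ {n k : ℕ} (adj : Rel₂ n) (w : Fin n → Fin n → ℕ) →
    IsGraph adj → SymW w → Connected adj →
    (ℓ : Fin n → ℕ) → IsLowerBound adj w ℓ →
    (col : Fin n → Fin k) →
    (∀ u v → ¬ SameComp adj w ℓ u v → col u ≢ col v) →
    (W : Fin n → Bool) (F : Rel₂ n) →
    IsPCCSOptimal (PadEdge adj w ℓ) (wPad adj w) col ℓ W F →
    IsPSCSolution adj (λ u v → (F u v ∧ adj u v) ∨ Eℓ adj w ℓ u v) ×
    pscCost (λ u v → (F u v ∧ adj u v) ∨ Eℓ adj w ℓ u v) w
      ≤ pccsCost (wPad adj w) ℓ W F + sumF (λ v → if W v then 0 else ℓ v)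
lemma2 adj w (adj-sym , _) w-sym _ ℓ _ col disjoint W F (solution , _) =
  lifted-isPSCSolution adj-sym w-sym disjoint solution , lifted-cost (proj₁ (proj₂ (proj₂ solution)))
  where open Obligatory adj w ℓ
        open Lift col W F
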